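{- Let $R$ be an eDCTRS. Then: (1) $R$ is $\mathbb{U}_{\mathrm{opt}}$-NE iff $(R)^{ -1}$ is a 3-eDCTRS; (2) if $R$ is $\mathbb{U}_{\mathrm{opt}}$-NE, then (a) $\mathbb{U}_{\mathrm{opt}}((R)^{ -1})=(\mathbb{U}_{\mathrm{opt}}(R))^{ -1}$ up to renaming of U symbols (namely $U^\rho_i=U^{(\rho)^{ -1}}_{k-i+1}$ for $1\le i\le k$), (b) $R$ is $\mathbb{U}_{\mathrm{opt}}$-LL iff $(R)^{ -1}$ is $\mathbb{U}_{\mathrm{opt}}$-RL, and (c) $R$ is $\mathbb{U}_{\mathrm{opt}}$-RL iff $(R)^{ -1}$ is $\mathbb{U}_{\mathrm{opt}}$-LL; (3) $R$ is non-LV iff $(R)^{ -1}$ is non-RV; (4) $R$ is non-RV iff $(R)^{ -1}$ is non-LV.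
   Context: $\mathrm{Var}(\cdot)$ variables occurring; linear term: no variable twice. Extended conditional rule $\rho: l\to r\Leftarrow s_1\twoheadrightarrow t_1;\dots;s_k\twoheadrightarrow t_k$ ($k\ge0$, $l$ may be a variable); eCTRS = set of such rules; deterministic: $\mathrm{Var}(s_i)\subseteq\mathrm{Var}(l,t_1,\dots,t_{i-1})$ for all $i$; eDCTRS: all rules deterministic; Type 3: $\mathrm{Var}(r)\subseteq\mathrm{Var}(l,s_1,t_1,\dots,s_k,t_k)$; 3-eDCTRS: all rules deterministic and of Type 3. Rule properties: LL ($l$ linear), RL ($r$ linear), NE ($\mathrm{Var}(l)\subseteq\mathrm{Var}(r)$), non-LV ($l\notin\mathcal{V}$), non-RV ($r\notin\mathcal{V}$); a rule set has a property if all rules do. Inversion: $(l\to r\Leftarrow s_1\twoheadrightarrow t_1;\dots;s_k\twoheadrightarrow t_k)^{ -1}=r\to l\Leftarrow t_k\twoheadrightarrow s_k;\dots;t_1\twoheadrightarrow s_1$, and $(R)^{ -1}=\{(\rho)^{ -1}\mid\rho\in R\}$ (for unconditional rules this just swaps sides). Optimized unraveling: for $k\ge1$, $X_i=\mathrm{Var}(l,t_1,\dots,t_{i-1})$, $Y_i=\mathrm{Var}(r,t_i,s_{i+1},t_{i+1},\dots,s_k,t_k)$, $Z_i=X_i\cap Y_i$, $\overrightarrow{X}$ a fixed listing of a finite set $X$, fresh symbols $U^\rho_1,\dots,U^\rho_k$; $\mathbb{U}_{\mathrm{opt}}(\rho)=\{l\to U^\rho_1(s_1,\overrightarrow{Z_1})\}\cup\{U^\rho_i(t_i,\overrightarrow{Z_i})\to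 U^\rho_{i+1}(s_{i+1},\overrightarrow{Z_{i+1}})\mid1\le i<k\}\cup\{U^\rho_k(t_k,\overrightarrow{Z_k})\to r\}$, unconditional rules kept, $\mathbb{U}_{\mathrm{opt}}(R)=\bigcup_\rho\mathbb{U}_{\mathrm{opt}}(\rho)$. $R$ is $\mathbb{U}_{\mathrm{opt}}$-P if all rules of $\mathbb{U}_{\mathrm{opt}}(R)$ have property P. -}

module Defs where

open import Data.Nat using (ℕ; zero; suc; _⊔_; _∸_)
open import Data.Nat.Properties using (_≟_)
open import Data.List using (List; []; _∷_; _++_; map; concatMap; foldr; filter; take; drop; reverse; zipWith; upTo; length; [_])
open import Data.List.Membership.DecPropositional _≟_ using (_∈?_)
open import Data.List.Relation.Binary.Subset.Propositional using (_⊆_)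
open import Data.List.Relation.Unary.All using (All)
open import Data.List.Relation.Unary.Unique.Propositional using (Unique)
open import Data.List using (lookup)
open import Data.Fin using (Fin; toℕ)
open import Data.Product using (_×_; _,_; proj₁; proj₂; ∃; swap)
open import Data.Sum using (_⊎_; inj₁; inj₂)
open import Relation.Nullary using (¬_)
open import Relation.Binary.PropositionalEquality using (_≡_)

data Term (F : Set) : Set where
  var : ℕ → Term F
  fun : F → List (Term F) → Term F

module _ {F : Set} where
  -- Var(t), as a list (with possible repetitions, in occurrence order)
  vars  : Term F → List ℕ
  varsL : List (Term F) → List ℕ
  vars (var x) = x ∷ []
  vars (fun f ts) = varsL ts
  varsL [] = []
  varsL (t ∷ ts) = vars t ++ varsL ts

  IsVar : Term F → Set
  IsVar t = ∃ λ x → t ≡ var x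

mapSym  : {A B : Set} → (A → B) → Term A → Term B
mapSymL : {A B : Set} → (A → B) → List (Term A) → List (Term B)
mapSym g (var x) = var x
mapSym g (fun f ts) = fun (g f) (mapSymL g ts)
mapSymL g [] = []
mapSymL g (t ∷ ts) = mapSym g t ∷ mapSymL g ts

record Rule (G : Set) : Set where
  constructor _⟶_
  field
    lhs : Term G
    rhs : Term G
open Rule public

module _ {G : Set} where
  LL RL NE nonLV nonRV : Rule G → Set
  LL ρ = Unique (vars (lhs ρ))
  RL ρ = Unique (vars (rhs ρ))
  NE ρ = vars (lhs ρ) ⊆ vars (rhs ρ)
  nonLV ρ = ¬ IsVar (lhs ρ)
  nonRV ρ = ¬ IsVar (rhs ρ)

  invRule : Rule G → Rule G
  invRule (l ⟶ r) = r ⟶ l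

  invTRS : List (Rule G) → List (Rule G)
  invTRS = map invRule

-- equality of rule sets (lists read as sets)
_≋_ : {G : Set} → List (Rule G) → List (Rule G) → Set
A ≋ B = (A ⊆ B) × (B ⊆ A)

-- Extended conditional rules  l → r ⇐ s₁ ↠ t₁; …; sₖ ↠ tₖ
-- (conds is the list [(s₁,t₁), …, (sₖ,tₖ)]; l may be a variable)

record CRule (F : Set) : Set where
  constructor _⇒_⇐_
  field
    clhs  : Term F
    crhs  : Term F
    conds : List (Term F × Term F)
open CRule public

module _ {F : Set} where
  invC : CRule F → CRule F
  invC (l ⇒ r ⇐ cs) = r ⇒ l ⇐ reverse (map swap cs)

  invR : List (CRule F) → List (CRule F)
  invR = map invC

  -- deterministic: Var(sᵢ) ⊆ Var(l, t₁, …, tᵢ₋₁)  (i is 0-indexed here)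
  Deterministic : CRule F → Set
  Deterministic ρ = (i : Fin (length (conds ρ))) →
    vars (proj₁ (lookup (conds ρ) i)) ⊆
      (vars (clhs ρ) ++ concatMap (λ c → vars (proj₂ c)) (take (toℕ i) (conds ρ)))

  Type3 : CRule F → Set
  Type3 ρ = vars (crhs ρ) ⊆
    (vars (clhs ρ) ++ concatMap (λ c → vars (proj₁ c) ++ vars (proj₂ c)) (conds ρ))

  IseDCTRS : List (CRule F) → Set
  IseDCTRS R = All Deterministic R

  Is3eDCTRS : List (CRule F) → Set
  Is3eDCTRS R = All (λ ρ → Deterministic ρ × Type3 ρ) R

  NonLVR NonRVR : List (CRule F) → Set
  NonLVR R = All (λ ρ → ¬ IsVar (clhs ρ)) R
  NonRVR R = All (λ ρ → ¬ IsVar (crhs ρ)) R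

-- Optimized unraveling.
-- Signature of the unraveled TRS: original symbols plus fresh symbols
-- U^ρ_i, represented as inj₂ (ρ , i).

USig : Set → Set
USig F = F ⊎ (CRule F × ℕ)

-- canonical ("fixed") listing of a finite set of variables: ascending order
listing : List ℕ → List ℕ
listing xs = filter (_∈? xs) (upTo (suc (foldr _⊔_ 0 xs)))

module _ {F : Set} where
  embed : Term F → Term (USig F)
  embed = mapSym inj₁

  module Unravel (ρ : CRule F) where
    l = clhs ρ
    r = crhs ρ
    cs = conds ρ
    k = length cs

    -- 1-indexed i
    Xᵢ : ℕ → List ℕ
    Xᵢ i = vars l ++ concatMap (λ c → vars (proj₂ c)) (take (i ∸ 1) cs)

    Yᵢ : ℕ → List ℕ
    Yᵢ i = vars r ++ concatMap (λ c → vars (proj₂ c)) (drop (i ∸ 1) cs)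
                  ++ concatMap (λ c → vars (proj₁ c)) (drop i cs)

    Zᵢ : ℕ → List ℕ
    Zᵢ i = listing (filter (_∈? Yᵢ i) (Xᵢ i))

    Uᵢ : ℕ → Term F → Term (USig F)
    Uᵢ i t = fun (inj₂ (ρ , i)) (embed t ∷ map var (Zᵢ i))

    idx : List ℕ
    idx = map suc (upTo k)

    As : List (Term (USig F))
    As = embed l ∷ zipWith Uᵢ idx (map proj₂ cs)

    Bs : List (Term (USig F))
    Bs = zipWith Uᵢ idx (map proj₁ cs) ++ [ embed r ]

    -- for k = 0 this is just [ l → r ] (unconditional rules kept)
    rules : List (Rule (USig F))
    rules = zipWith _⟶_ As Bs

  Uopt : CRule F → List (Rule (USig F))
  Uopt ρ = Unravel.rules ρ

  UoptR : List (CRule F) → List (Rule (USig F))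
  UoptR R = concatMap Uopt R

  UoptHas : (Rule (USig F) → Set) → List (CRule F) → Set
  UoptHas P R = All P (UoptR R)

  renameU : USig F → USig F
  renameU (inj₁ f) = inj₁ f
  renameU (inj₂ (ρ , i)) = inj₂ (invC ρ , suc (length (conds ρ) ∸ i))

  renameRule : Rule (USig F) → Rule (USig F)
  renameRule (l ⟶ r) = mapSym renameU l ⟶ mapSym renameU r

module Submission where

-- Everything is proved rule by rule and then lifted to rule lists with All.
-- For ρ = l → r ⇐ s₁ ↠ t₁; …; sₖ ↠ tₖ we index the k+1 unraveled rules by
-- their position n ≤ k (Uopt ρ = applyUpTo (ruleAt ρ) (k+1)) and describe
-- the members of each Zᵢ by occurrence conditions over ranges of condition
-- positions.  Condition j of ρ⁻¹ is condition k-1-j of ρ with sides swapped,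
-- so these occurrence conditions transform by mirroring index ranges.
--
-- Central notion: ρ is forward if every variable of tᵢ occurs in r or in
-- some sⱼ with j > i.  We show
--   * all unraveled rules of ρ are NE  ⇔  ρ is forward and every variable of
--     l occurs in r or some sⱼ  ⇔  ρ⁻¹ is deterministic and of Type 3;
--   * if ρ is deterministic and forward, Zᵢ(ρ⁻¹) = Z_{k-i+1}(ρ), so the n-th
--     unraveled rule of ρ⁻¹ is the renamed inverse of the (k-n)-th one of ρ.
-- These give parts (1) and (2a).  Parts (2b) and (2c) transfer along (2a),
-- as inversion swaps the sides of a rule and renaming keeps variable lists;
-- parts (3) and (4) are immediate since inversion swaps l and r.

open import Defs
open import Data.Nat using (ℕ; zero; suc; _⊔_; _∸_; _+_; _≤_; _<_; z≤n; s≤s; s≤s⁻¹)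
open import Data.Nat.Properties
open import Data.List using (List; []; _∷_; _++_; map; concatMap; foldr; filter; take; drop; reverse; zipWith; upTo; length; [_]; applyUpTo; lookup)
open import Data.List.Properties using (length-reverse; unfold-reverse; length-map; map-applyUpTo; map-++)
open import Data.List.Relation.Binary.Subset.Propositional.Properties using (++⁺)
open import Data.List.Membership.Propositional using (_∈_)
open import Data.List.Membership.Propositional.Properties using (∈-++⁺ˡ; ∈-++⁺ʳ; ∈-++⁻; ∈-map⁺; ∈-map⁻; ∈-applyUpTo⁺; ∈-applyUpTo⁻; ∈-filter⁺; ∈-filter⁻; ∈-upTo⁺)
open import Data.List.Membership.DecPropositional _≟_ using (_∈?_)
open import Data.List.Relation.Binary.Subset.Propositional using (_⊆_)
open import Data.List.Relation.Unary.Any using (here; there)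
open import Data.List.Relation.Unary.All using (All; []; _∷_)
import Data.List.Relation.Unary.All as All
import Data.List.Relation.Unary.All.Properties as All
open import Data.List.Relation.Unary.Unique.Propositional using (Unique)
open import Data.Fin using (Fin; toℕ; fromℕ<)
import Data.Fin as Fin
open import Data.Fin.Properties using (toℕ<n; toℕ-fromℕ<)
open import Data.Product using (_×_; _,_; proj₁; proj₂; ∃; swap)
open import Data.Sum using (_⊎_; inj₁; inj₂)
open import Data.Empty using (⊥-elim)
open import Relation.Nullary using (¬_; yes; no)
open import Function.Bundles using (_⇔_; mk⇔; Equivalence)
open import Function.Construct.Identity using (⇔-id)
open import Function.Construct.Composition using (_⇔-∘_)
open import Function.Construct.Symmetry using (⇔-sym)
open import Relation.Binary.PropositionalEquality hiding ([_])

-- Mirroring positions: in a list of length k, position j corresponds to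
-- position k ∸ suc j of the reversed list.

suc-mirror : ∀ {j k} → j < k → suc (k ∸ suc j) ≡ k ∸ j
suc-mirror j<k = sym (+-∸-assoc 1 j<k)

mirror-mirror : ∀ {j k} → j < k → k ∸ suc (k ∸ suc j) ≡ j
mirror-mirror {j} {k} j<k = trans (cong (k ∸_) (suc-mirror j<k)) (m∸[m∸n]≡n (<⇒≤ j<k))

mirror-< : ∀ {j k} → j < k → k ∸ suc j < k
mirror-< {j} {k} j<k = subst (_≤ k) (sym (suc-mirror j<k)) (m∸n≤m k j)

-- The mirror image of [lo, hi) is [k ∸ hi, k ∸ lo); the next two lemmas
-- give the two bounds needed when mirroring a position back.
mirror-lower : ∀ k lo i → i < k ∸ lo → lo ≤ k ∸ suc i
mirror-lower k zero i _ = z≤n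
mirror-lower (suc k) (suc lo) i i<k∸lo =
  subst (suc lo ≤_) (suc-mirror (≤-trans i<k∸lo (m∸n≤m k lo))) (s≤s (mirror-lower k lo i i<k∸lo))

mirror-upper : ∀ k hi i → k ∸ hi ≤ i → i < k → k ∸ suc i < hi
mirror-upper k hi i k∸hi≤i i<k = subst (_≤ hi) (sym (suc-mirror i<k)) (m≤n+o⇒m∸n≤o k i k≤i+hi)
  where
  k≤i+hi : k ≤ i + hi
  k≤i+hi = ≤-trans (m≤n+m∸n k hi) (≤-trans (+-monoʳ-≤ hi k∸hi≤i) (≤-reflexive (+-comm hi i)))

nth : {A : Set} → A → List A → ℕ → A
nth d [] j = d
nth d (x ∷ xs) zero = x
nth d (x ∷ xs) (suc j) = nth d xs j

nth-map : ∀ {A B : Set} (f : A → B) d xs j → nth (f d) (map f xs) j ≡ f (nth d xs j)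
nth-map f d [] j = refl
nth-map f d (x ∷ xs) zero = refl
nth-map f d (x ∷ xs) (suc j) = nth-map f d xs j

module _ {A : Set} (d : A) where
  lookup≡nth : ∀ (xs : List A) i → lookup xs i ≡ nth d xs (toℕ i)
  lookup≡nth (x ∷ xs) Fin.zero = refl
  lookup≡nth (x ∷ xs) (Fin.suc i) = lookup≡nth xs i

  nth-++ˡ : ∀ xs ys j → j < length xs → nth d (xs ++ ys) j ≡ nth d xs j
  nth-++ˡ (x ∷ xs) ys zero _ = refl
  nth-++ˡ (x ∷ xs) ys (suc j) j<n = nth-++ˡ xs ys j (s≤s⁻¹ j<n)

  nth-last : ∀ xs y → nth d (xs ++ [ y ]) (length xs) ≡ y
  nth-last [] y = refl
  nth-last (x ∷ xs) y = nth-last xs y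

  nth-reverse : ∀ xs j → j < length xs → nth d (reverse xs) j ≡ nth d xs (length xs ∸ suc j)
  nth-reverse (x ∷ xs) j j<n rewrite unfold-reverse x xs with m≤n⇒m<n∨m≡n (s≤s⁻¹ j<n)
  ... | inj₁ j<len = begin
    nth d (reverse xs ++ [ x ]) j      ≡⟨ nth-++ˡ (reverse xs) [ x ] j (subst (j <_) (sym (length-reverse xs)) j<len) ⟩
    nth d (reverse xs) j               ≡⟨ nth-reverse xs j j<len ⟩
    nth d xs (length xs ∸ suc j)       ≡⟨ cong (nth d (x ∷ xs)) (suc-mirror j<len) ⟩
    nth d (x ∷ xs) (length xs ∸ j)     ∎
    where open ≡-Reasoning
  ... | inj₂ refl = begin
    nth d (reverse xs ++ [ x ]) (length xs)            ≡⟨ cong (nth d (reverse xs ++ [ x ])) (sym (length-reverse xs)) ⟩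
    nth d (reverse xs ++ [ x ]) (length (reverse xs))  ≡⟨ nth-last (reverse xs) x ⟩
    x                                                  ≡⟨ cong (nth d (x ∷ xs)) (sym (n∸n≡0 (length xs))) ⟩
    nth d (x ∷ xs) (length xs ∸ length xs)             ∎
    where open ≡-Reasoning

module _ {A : Set} (d : A) where
  data Occurs (f : A → List ℕ) (xs : List A) (lo hi x : ℕ) : Set where
    at : ∀ j → lo ≤ j → j < hi → j < length xs → x ∈ f (nth d xs j) → Occurs f xs lo hi x

  module _ {f : A → List ℕ} {x : ℕ} where
    occurs-weaken : ∀ {xs lo hi lo′ hi′} → lo′ ≤ lo → hi ≤ hi′ → Occurs f xs lo hi x → Occurs f xs lo′ hi′ x
    occurs-weaken lo′≤lo hi≤hi′ (at j lo≤j j<hi j<n occ) = at j (≤-trans lo′≤lo lo≤j) (≤-trans j<hi hi≤hi′) j<n occ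

    occurs-map : ∀ {g : A → List ℕ} {xs lo hi} → (∀ a → x ∈ f a → x ∈ g a) → Occurs f xs lo hi x → Occurs g xs lo hi x
    occurs-map f⊆g (at j lo≤j j<hi j<n occ) = at j lo≤j j<hi j<n (f⊆g _ occ)

    occurs-∷ : ∀ {y xs lo hi} → Occurs f xs lo hi x → Occurs f (y ∷ xs) lo (suc hi) x
    occurs-∷ (at j lo≤j j<hi j<n occ) = at (suc j) (m≤n⇒m≤1+n lo≤j) (s≤s j<hi) (s≤s j<n) occ

    occurs-concatMap⁻ : ∀ xs → x ∈ concatMap f xs → Occurs f xs 0 (length xs) x
    occurs-concatMap⁻ (y ∷ xs) x∈ with ∈-++⁻ (f y) x∈
    ... | inj₁ x∈y = at 0 z≤n (s≤s z≤n) (s≤s z≤n) x∈y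
    ... | inj₂ x∈ys = occurs-∷ (occurs-concatMap⁻ xs x∈ys)

    occurs-concatMap⁺ : ∀ xs {lo hi} → Occurs f xs lo hi x → x ∈ concatMap f xs
    occurs-concatMap⁺ (y ∷ xs) (at zero _ _ _ occ) = ∈-++⁺ˡ occ
    occurs-concatMap⁺ (y ∷ xs) (at (suc j) _ _ j<n occ) =
      ∈-++⁺ʳ (f y) (occurs-concatMap⁺ xs (at j z≤n (s≤s⁻¹ j<n) (s≤s⁻¹ j<n) occ))

    occurs-take⁻ : ∀ n xs → x ∈ concatMap f (take n xs) → Occurs f xs 0 n x
    occurs-take⁻ (suc n) (y ∷ xs) x∈ with ∈-++⁻ (f y) x∈
    ... | inj₁ x∈y = at 0 z≤n (s≤s z≤n) (s≤s z≤n) x∈y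
    ... | inj₂ x∈ys = occurs-∷ (occurs-take⁻ n xs x∈ys)

    occurs-take⁺ : ∀ n xs → Occurs f xs 0 n x → x ∈ concatMap f (take n xs)
    occurs-take⁺ (suc n) (y ∷ xs) (at zero _ _ _ occ) = ∈-++⁺ˡ occ
    occurs-take⁺ (suc n) (y ∷ xs) (at (suc j) _ j<n j<len occ) =
      ∈-++⁺ʳ (f y) (occurs-take⁺ n xs (at j z≤n (s≤s⁻¹ j<n) (s≤s⁻¹ j<len) occ))

    occurs-drop⁻ : ∀ n xs → x ∈ concatMap f (drop n xs) → Occurs f xs n (length xs) x
    occurs-drop⁻ zero xs x∈ = occurs-concatMap⁻ xs x∈
    occurs-drop⁻ (suc n) (y ∷ xs) x∈ with occurs-drop⁻ n xs x∈
    ... | at j n≤j j<hi j<len occ = at (suc j) (s≤s n≤j) (s≤s j<hi) (s≤s j<len) occ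

    occurs-drop⁺ : ∀ n xs {hi} → Occurs f xs n hi x → x ∈ concatMap f (drop n xs)
    occurs-drop⁺ zero xs occ = occurs-concatMap⁺ xs occ
    occurs-drop⁺ (suc n) (y ∷ xs) (at (suc j) n≤j _ j<len occ) =
      occurs-drop⁺ n xs (at j (s≤s⁻¹ n≤j) (s≤s⁻¹ j<len) (s≤s⁻¹ j<len) occ)

-- Reversing a list of pairs and swapping each pair: an occurrence in the
-- positions [lo, hi) of the result is an occurrence, in the swapped
-- components, in the mirrored positions [k ∸ hi, k ∸ lo) of the original.

revSwap : {B : Set} → List (B × B) → List (B × B)
revSwap cs = reverse (map swap cs)

module _ {B : Set} (b : B) where
  private d = (b , b)

  length-revSwap : ∀ (cs : List (B × B)) → length (revSwap cs) ≡ length cs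
  length-revSwap cs = trans (length-reverse (map swap cs)) (length-map swap cs)

  nth-revSwap : ∀ cs j → j < length cs → nth d (revSwap cs) j ≡ swap (nth d cs (length cs ∸ suc j))
  nth-revSwap cs j j<k = begin
    nth d (reverse (map swap cs)) j                           ≡⟨ nth-reverse d (map swap cs) j (subst (j <_) (sym (length-map swap cs)) j<k) ⟩
    nth d (map swap cs) (length (map swap cs) ∸ suc j)         ≡⟨ cong (λ n → nth d (map swap cs) (n ∸ suc j)) (length-map swap cs) ⟩
    nth d (map swap cs) (length cs ∸ suc j)                   ≡⟨ nth-map swap d cs _ ⟩
    swap (nth d cs (length cs ∸ suc j))                       ∎
    where open ≡-Reasoning

  occurs-revSwap⁻ : ∀ f cs {lo hi x} → Occurs d f (revSwap cs) lo hi x →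
    Occurs d (λ c → f (swap c)) cs (length cs ∸ hi) (length cs ∸ lo) x
  occurs-revSwap⁻ f cs {lo} {hi} (at j lo≤j j<hi j<n occ) =
    at (k ∸ suc j) (∸-monoʳ-≤ k j<hi) (subst (_≤ k ∸ lo) (sym (suc-mirror j<k)) (∸-monoʳ-≤ k lo≤j))
       (mirror-< j<k) (subst (λ c → _ ∈ f c) (nth-revSwap cs j j<k) occ)
    where
    k = length cs
    j<k = subst (j <_) (length-revSwap cs) j<n

  occurs-revSwap⁺ : ∀ f cs {lo hi x} → Occurs d (λ c → f (swap c)) cs (length cs ∸ hi) (length cs ∸ lo) x →
    Occurs d f (revSwap cs) lo hi x
  occurs-revSwap⁺ f cs {lo} {hi} (at i k∸hi≤i i<k∸lo i<k occ) =
    at j (mirror-lower k lo i i<k∸lo) (mirror-upper k hi i k∸hi≤i i<k)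
       (subst (j <_) (sym (length-revSwap cs)) (mirror-< i<k))
       (subst (λ c → _ ∈ f c) (sym (trans (nth-revSwap cs j (mirror-< i<k)) (cong (λ n → swap (nth d cs n)) (mirror-mirror i<k)))) occ)
    where
    k = length cs
    j = k ∸ suc i

maxVar : List ℕ → ℕ
maxVar xs = foldr _⊔_ 0 xs

∈⇒≤maxVar : ∀ {x} xs → x ∈ xs → x ≤ maxVar xs
∈⇒≤maxVar (y ∷ xs) (here refl) = m≤m⊔n y (maxVar xs)
∈⇒≤maxVar (y ∷ xs) (there x∈) = ≤-trans (∈⇒≤maxVar xs x∈) (m≤n⊔m y (maxVar xs))

maxVar-lub : ∀ xs m → (∀ {x} → x ∈ xs → x ≤ m) → maxVar xs ≤ m
maxVar-lub [] m _ = z≤n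
maxVar-lub (y ∷ xs) m bound = ⊔-lub (bound (here refl)) (maxVar-lub xs m (λ x∈ → bound (there x∈)))

module _ (xs ys : List ℕ) (xs⊆ys : xs ⊆ ys) (ys⊆xs : ys ⊆ xs) where
  filter-∈-cong : ∀ zs → filter (_∈? xs) zs ≡ filter (_∈? ys) zs
  filter-∈-cong [] = refl
  filter-∈-cong (z ∷ zs) with z ∈? xs | z ∈? ys
  ... | yes _ | yes _ = cong (z ∷_) (filter-∈-cong zs)
  ... | yes z∈xs | no z∉ys = ⊥-elim (z∉ys (xs⊆ys z∈xs))
  ... | no z∉xs | yes z∈ys = ⊥-elim (z∉xs (ys⊆xs z∈ys))
  ... | no _ | no _ = filter-∈-cong zs

  listing-cong : listing xs ≡ listing ys
  listing-cong = trans (cong (λ m → filter (_∈? xs) (upTo (suc m))) same-max) (filter-∈-cong _)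
    where
    same-max : maxVar xs ≡ maxVar ys
    same-max = ≤-antisym (maxVar-lub xs _ (λ x∈ → ∈⇒≤maxVar ys (xs⊆ys x∈)))
                         (maxVar-lub ys _ (λ y∈ → ∈⇒≤maxVar xs (ys⊆xs y∈)))

listing⁻ : ∀ xs {x} → x ∈ listing xs → x ∈ xs
listing⁻ xs x∈ = proj₂ (∈-filter⁻ (_∈? xs) x∈)

listing⁺ : ∀ xs {x} → x ∈ xs → x ∈ listing xs
listing⁺ xs x∈ = ∈-filter⁺ (_∈? xs) (∈-upTo⁺ (s≤s (∈⇒≤maxVar xs x∈))) x∈

listing-ext : ∀ xs ys → listing xs ⊆ listing ys → listing ys ⊆ listing xs → listing xs ≡ listing ys
listing-ext xs ys xs⊆ys ys⊆xs = listing-cong xs ys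
  (λ x∈ → listing⁻ ys (xs⊆ys (listing⁺ xs x∈))) (λ y∈ → listing⁻ xs (ys⊆xs (listing⁺ ys y∈)))

module _ {A B : Set} (g : A → B) where
  vars-mapSym : ∀ t → vars (mapSym g t) ≡ vars t
  varsL-mapSymL : ∀ ts → varsL (mapSymL g ts) ≡ varsL ts
  vars-mapSym (var x) = refl
  vars-mapSym (fun f ts) = varsL-mapSymL ts
  varsL-mapSymL [] = refl
  varsL-mapSymL (t ∷ ts) = cong₂ _++_ (vars-mapSym t) (varsL-mapSymL ts)

  mapSymL-vars : ∀ zs → mapSymL g (map var zs) ≡ map var zs
  mapSymL-vars [] = refl
  mapSymL-vars (z ∷ zs) = cong (var z ∷_) (mapSymL-vars zs)

varsL-vars : ∀ {F : Set} zs → varsL {F} (map var zs) ≡ zs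
varsL-vars [] = refl
varsL-vars (z ∷ zs) = cong (z ∷_) (varsL-vars zs)

module _ {F : Set} where
  renameU-embed : ∀ t → mapSym (renameU {F}) (embed t) ≡ embed t
  renameU-embedL : ∀ ts → mapSymL (renameU {F}) (mapSymL inj₁ ts) ≡ mapSymL inj₁ ts
  renameU-embed (var x) = refl
  renameU-embed (fun f ts) = cong (fun (inj₁ f)) (renameU-embedL ts)
  renameU-embedL [] = refl
  renameU-embedL (t ∷ ts) = cong₂ _∷_ (renameU-embed t) (renameU-embedL ts)

  ∈-renamedInverse⁺ : ∀ {A : List (Rule (USig F))} {z} → z ∈ A → renameRule (invRule z) ∈ map renameRule (invTRS A)
  ∈-renamedInverse⁺ z∈ = ∈-map⁺ renameRule (∈-map⁺ invRule z∈)

  ∈-renamedInverse⁻ : ∀ {A : List (Rule (USig F))} {x} → x ∈ map renameRule (invTRS A) →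
    ∃ λ z → z ∈ A × x ≡ renameRule (invRule z)
  ∈-renamedInverse⁻ x∈ with ∈-map⁻ renameRule x∈
  ... | y , y∈ , refl with ∈-map⁻ invRule y∈
  ... | z , z∈ , refl = z , z∈ , refl

  ∈-embed⁻ : ∀ t {x} → x ∈ vars (embed {F} t) → x ∈ vars t
  ∈-embed⁻ t = subst (_ ∈_) (vars-mapSym inj₁ t)

  ∈-embed⁺ : ∀ t {x} → x ∈ vars t → x ∈ vars (embed {F} t)
  ∈-embed⁺ t = subst (_ ∈_) (sym (vars-mapSym inj₁ t))

extendAt : {X : Set} → ℕ → (ℕ → X) → X → ℕ → X
extendAt zero f z n = z
extendAt (suc k) f z zero = f 0
extendAt (suc k) f z (suc n) = extendAt k (λ i → f (suc i)) z n

extendAt-< : {X : Set} → ∀ k (f : ℕ → X) z n → n < k → extendAt k f z n ≡ f n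
extendAt-< (suc k) f z zero _ = refl
extendAt-< (suc k) f z (suc n) n<k = extendAt-< k (λ i → f (suc i)) z n (s≤s⁻¹ n<k)

extendAt-last : {X : Set} → ∀ k (f : ℕ → X) z → extendAt k f z k ≡ z
extendAt-last zero f z = refl
extendAt-last (suc k) f z = extendAt-last k (λ i → f (suc i)) z

applyUpTo-++-last : {X : Set} → ∀ k (f : ℕ → X) z → applyUpTo f k ++ [ z ] ≡ applyUpTo (extendAt k f z) (suc k)
applyUpTo-++-last zero f z = refl
applyUpTo-++-last (suc k) f z = cong (f 0 ∷_) (applyUpTo-++-last k (λ i → f (suc i)) z)

zipWith-applyUpTo : {X Y W : Set} (f : X → Y → W) → ∀ a b n →
  zipWith f (applyUpTo a n) (applyUpTo b n) ≡ applyUpTo (λ i → f (a i) (b i)) n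
zipWith-applyUpTo f a b zero = refl
zipWith-applyUpTo f a b (suc n) = cong (f (a 0) (b 0) ∷_) (zipWith-applyUpTo f (λ i → a (suc i)) (λ i → b (suc i)) n)

zipWith-positions : {A X W : Set} (d : A) (f : ℕ → X → W) (h : A → X) → ∀ (g : ℕ → ℕ) xs →
  zipWith f (applyUpTo g (length xs)) (map h xs) ≡ applyUpTo (λ n → f (g n) (h (nth d xs n))) (length xs)
zipWith-positions d f h g [] = refl
zipWith-positions d f h g (x ∷ xs) = cong (f (g 0) (h x) ∷_) (zipWith-positions d f h (λ i → g (suc i)) xs)

Cond : Set → Set
Cond F = Term F × Term F

module _ {F : Set} where
  -- Out-of-range default; every use below is at an in-range position.
  noCond : Cond F
  noCond = var 0 , var 0

  ncond : CRule F → ℕ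
  ncond ρ = length (conds ρ)

  -- sⱼ₊₁ and tⱼ₊₁ of ρ, at 0-indexed position j
  sAt tAt : CRule F → ℕ → Term F
  sAt ρ j = proj₁ (nth noCond (conds ρ) j)
  tAt ρ j = proj₂ (nth noCond (conds ρ) j)

  varsS varsT : Cond F → List ℕ
  varsS c = vars (proj₁ c)
  varsT c = vars (proj₂ c)

  OccursS OccursT : CRule F → ℕ → ℕ → ℕ → Set
  OccursS ρ = Occurs noCond varsS (conds ρ)
  OccursT ρ = Occurs noCond varsT (conds ρ)

  U : CRule F → ℕ → Term F → Term (USig F)
  U ρ = Unravel.Uᵢ ρ

  Z : CRule F → ℕ → List ℕ
  Z ρ = Unravel.Zᵢ ρ

  -- The n-th unraveled rule (0 ≤ n ≤ k): l → U₁(s₁,…) for n = 0,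
  -- Uₙ(tₙ,…) → Uₙ₊₁(sₙ₊₁,…) in between, and Uₖ(tₖ,…) → r for n = k.
  lhsAt rhsAt : CRule F → ℕ → Term (USig F)
  lhsAt ρ zero = embed (clhs ρ)
  lhsAt ρ (suc m) = U ρ (suc m) (tAt ρ m)
  rhsAt ρ = extendAt (ncond ρ) (λ n → U ρ (suc n) (sAt ρ n)) (embed (crhs ρ))

  ruleAt : CRule F → ℕ → Rule (USig F)
  ruleAt ρ n = lhsAt ρ n ⟶ rhsAt ρ n

  rhsAt-< : ∀ ρ n → n < ncond ρ → rhsAt ρ n ≡ U ρ (suc n) (sAt ρ n)
  rhsAt-< ρ = extendAt-< (ncond ρ) (λ n → U ρ (suc n) (sAt ρ n)) (embed (crhs ρ))

  rhsAt-last : ∀ ρ → rhsAt ρ (ncond ρ) ≡ embed (crhs ρ)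
  rhsAt-last ρ = extendAt-last (ncond ρ) (λ n → U ρ (suc n) (sAt ρ n)) (embed (crhs ρ))

  Uopt-positions : ∀ ρ → Uopt ρ ≡ applyUpTo (ruleAt ρ) (suc (ncond ρ))
  Uopt-positions ρ
    rewrite map-applyUpTo (λ i → i) suc (ncond ρ)
          | zipWith-positions noCond (U ρ) proj₂ suc (conds ρ)
          | zipWith-positions noCond (U ρ) proj₁ suc (conds ρ)
          | applyUpTo-++-last (ncond ρ) (λ n → U ρ (suc n) (sAt ρ n)) (embed (crhs ρ))
    = zipWith-applyUpTo _⟶_ (lhsAt ρ) (rhsAt ρ) (suc (ncond ρ))

  ∈Uopt⁻ : ∀ ρ {x} → x ∈ Uopt ρ → ∃ λ n → n ≤ ncond ρ × x ≡ ruleAt ρ n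
  ∈Uopt⁻ ρ {x} x∈ with ∈-applyUpTo⁻ (ruleAt ρ) (subst (x ∈_) (Uopt-positions ρ) x∈)
  ... | n , n<k+1 , x≡ = n , s≤s⁻¹ n<k+1 , x≡

  ∈Uopt⁺ : ∀ ρ {n} → n ≤ ncond ρ → ruleAt ρ n ∈ Uopt ρ
  ∈Uopt⁺ ρ {n} n≤k = subst (ruleAt ρ n ∈_) (sym (Uopt-positions ρ)) (∈-applyUpTo⁺ (ruleAt ρ) (s≤s n≤k))

  vars-U : ∀ ρ i t → vars (U ρ i t) ≡ vars t ++ Z ρ i
  vars-U ρ i t = cong₂ _++_ (vars-mapSym inj₁ t) (varsL-vars (Z ρ i))

  ∈U⁻ : ∀ ρ i t {x} → x ∈ vars (U ρ i t) → x ∈ vars t ⊎ x ∈ Z ρ i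
  ∈U⁻ ρ i t x∈ = ∈-++⁻ (vars t) (subst (_ ∈_) (vars-U ρ i t) x∈)

  ∈U-arg : ∀ ρ i t {x} → x ∈ vars t → x ∈ vars (U ρ i t)
  ∈U-arg ρ i t x∈ = subst (_ ∈_) (sym (vars-U ρ i t)) (∈-++⁺ˡ x∈)

  ∈U-Z : ∀ ρ i t {x} → x ∈ Z ρ i → x ∈ vars (U ρ i t)
  ∈U-Z ρ i t x∈ = subst (_ ∈_) (sym (vars-U ρ i t)) (∈-++⁺ʳ (vars t) x∈)

  -- Each Zᵢ is a canonical listing, hence determined by its members.
  Z-ext : ∀ ρ i ρ′ j → Z ρ i ⊆ Z ρ′ j → Z ρ′ j ⊆ Z ρ i → Z ρ i ≡ Z ρ′ j
  Z-ext ρ i ρ′ j = listing-ext (filter (_∈? Unravel.Yᵢ ρ i) (Unravel.Xᵢ ρ i)) (filter (_∈? Unravel.Yᵢ ρ′ j) (Unravel.Xᵢ ρ′ j))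

  -- Membership in Z_{p+1} = X_{p+1} ∩ Y_{p+1}, by positions:
  -- X_{p+1} = Var(l) ∪ Var(tⱼ₊₁, j < p),
  -- Y_{p+1} = Var(r) ∪ Var(tⱼ₊₁, j ≥ p) ∪ Var(sⱼ₊₁, j > p).
  InX InY : CRule F → ℕ → ℕ → Set
  InX ρ p x = x ∈ vars (clhs ρ) ⊎ OccursT ρ 0 p x
  InY ρ p x = x ∈ vars (crhs ρ) ⊎ OccursT ρ p (ncond ρ) x ⊎ OccursS ρ (suc p) (ncond ρ) x

  ∈Z⁻ : ∀ ρ p {x} → x ∈ Z ρ (suc p) → InX ρ p x × InY ρ p x
  ∈Z⁻ ρ p {x} x∈ with ∈-filter⁻ (_∈? Unravel.Yᵢ ρ (suc p)) (listing⁻ _ x∈)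
  ... | x∈X , x∈Y = inX (∈-++⁻ (vars (clhs ρ)) x∈X) , inY (∈-++⁻ (vars (crhs ρ)) x∈Y)
    where
    inX : x ∈ vars (clhs ρ) ⊎ x ∈ concatMap varsT (take p (conds ρ)) → InX ρ p x
    inX (inj₁ x∈l) = inj₁ x∈l
    inX (inj₂ x∈ts) = inj₂ (occurs-take⁻ noCond p (conds ρ) x∈ts)
    inY : x ∈ vars (crhs ρ) ⊎ x ∈ concatMap varsT (drop p (conds ρ)) ++ concatMap varsS (drop (suc p) (conds ρ)) →
          InY ρ p x
    inY (inj₁ x∈r) = inj₁ x∈r
    inY (inj₂ x∈cs) with ∈-++⁻ (concatMap varsT (drop p (conds ρ))) x∈cs
    ... | inj₁ x∈ts = inj₂ (inj₁ (occurs-drop⁻ noCond p (conds ρ) x∈ts))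
    ... | inj₂ x∈ss = inj₂ (inj₂ (occurs-drop⁻ noCond (suc p) (conds ρ) x∈ss))

  ∈Z⁺ : ∀ ρ p {x} → InX ρ p x → InY ρ p x → x ∈ Z ρ (suc p)
  ∈Z⁺ ρ p {x} inX inY = listing⁺ _ (∈-filter⁺ (_∈? Unravel.Yᵢ ρ (suc p)) (∈X inX) (∈Y inY))
    where
    cs = conds ρ
    ∈X : InX ρ p x → x ∈ Unravel.Xᵢ ρ (suc p)
    ∈X (inj₁ x∈l) = ∈-++⁺ˡ x∈l
    ∈X (inj₂ occ) = ∈-++⁺ʳ (vars (clhs ρ)) (occurs-take⁺ noCond p cs occ)
    ∈Y : InY ρ p x → x ∈ Unravel.Yᵢ ρ (suc p)
    ∈Y (inj₁ x∈r) = ∈-++⁺ˡ x∈r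
    ∈Y (inj₂ (inj₁ occ)) = ∈-++⁺ʳ (vars (crhs ρ)) (∈-++⁺ˡ (occurs-drop⁺ noCond p cs occ))
    ∈Y (inj₂ (inj₂ occ)) =
      ∈-++⁺ʳ (vars (crhs ρ)) (∈-++⁺ʳ (concatMap varsT (drop p cs)) (occurs-drop⁺ noCond (suc p) cs occ))

module _ {F : Set} where
  UnravelNE : CRule F → Set
  UnravelNE ρ = ∀ n → n ≤ ncond ρ → vars (lhsAt ρ n) ⊆ vars (rhsAt ρ n)

  NeededFrom : CRule F → ℕ → ℕ → Set
  NeededFrom ρ i x = x ∈ vars (crhs ρ) ⊎ OccursS ρ i (ncond ρ) x

  neededFrom-weaken : ∀ ρ {i i′ x} → i′ ≤ i → NeededFrom ρ i x → NeededFrom ρ i′ x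
  neededFrom-weaken ρ i′≤i (inj₁ x∈r) = inj₁ x∈r
  neededFrom-weaken ρ i′≤i (inj₂ occ) = inj₂ (occurs-weaken noCond i′≤i ≤-refl occ)

  Forward : CRule F → Set
  Forward ρ = ∀ i → i < ncond ρ → ∀ {x} → x ∈ vars (tAt ρ i) → NeededFrom ρ (suc i) x

  LhsNeeded : CRule F → Set
  LhsNeeded ρ = ∀ {x} → x ∈ vars (clhs ρ) → NeededFrom ρ 0 x

  PositionallyDet : CRule F → Set
  PositionallyDet ρ = ∀ j → j < ncond ρ → ∀ {x} → x ∈ vars (sAt ρ j) → InX ρ j x

  deterministic⇒positionallyDet : ∀ ρ → Deterministic ρ → PositionallyDet ρ
  deterministic⇒positionallyDet ρ det j j<k {x} x∈s with ∈-++⁻ (vars (clhs ρ)) (det (fromℕ< j<k) x∈sⱼ)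
    where
    x∈sⱼ : x ∈ vars (proj₁ (lookup (conds ρ) (fromℕ< j<k)))
    x∈sⱼ = subst (λ c → x ∈ vars (proj₁ c))
      (sym (trans (lookup≡nth noCond (conds ρ) (fromℕ< j<k)) (cong (nth noCond (conds ρ)) (toℕ-fromℕ< j<k)))) x∈s
  ... | inj₁ x∈l = inj₁ x∈l
  ... | inj₂ x∈ts = inj₂ (subst (λ n → OccursT ρ 0 n x) (toℕ-fromℕ< j<k) (occurs-take⁻ noCond _ (conds ρ) x∈ts))

  NE-step : ∀ ρ → UnravelNE ρ → ∀ i → i < ncond ρ → ∀ {x} → x ∈ vars (tAt ρ i) →
    NeededFrom ρ (suc i) x ⊎ OccursT ρ (suc i) (ncond ρ) x
  NE-step ρ ne i i<k {x} x∈t with ne (suc i) i<k (∈U-arg ρ (suc i) (tAt ρ i) x∈t) | m≤n⇒m<n∨m≡n i<k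
  ... | x∈rhs | inj₂ i+1≡k =
    inj₁ (inj₁ (∈-embed⁻ (crhs ρ) (subst (λ t → x ∈ vars t) (trans (cong (rhsAt ρ) i+1≡k) (rhsAt-last ρ)) x∈rhs)))
  ... | x∈rhs | inj₁ i+1<k with ∈U⁻ ρ (suc (suc i)) (sAt ρ (suc i)) (subst (λ t → x ∈ vars t) (rhsAt-< ρ (suc i) i+1<k) x∈rhs)
  ... | inj₁ x∈s = inj₁ (inj₂ (at (suc i) ≤-refl i+1<k i+1<k x∈s))
  ... | inj₂ x∈Z with proj₂ (∈Z⁻ ρ (suc i) x∈Z)
  ... | inj₁ x∈r = inj₁ (inj₁ x∈r)
  ... | inj₂ (inj₁ occT) = inj₂ occT
  ... | inj₂ (inj₂ occS) = inj₁ (inj₂ (occurs-weaken noCond (n≤1+n _) ≤-refl occS))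

  -- Iterating NE-step (at most k times, since the position grows) shows that
  -- a rule with NE unraveled rules is forward.
  NE⇒forward : ∀ ρ → UnravelNE ρ → Forward ρ
  NE⇒forward ρ ne i i<k = chase (ncond ρ) i i<k (m≤n+m (ncond ρ) (suc i))
    where
    chase : ∀ fuel i → i < ncond ρ → ncond ρ ≤ suc i + fuel → ∀ {x} → x ∈ vars (tAt ρ i) → NeededFrom ρ (suc i) x
    chase fuel i i<k k≤ x∈t with NE-step ρ ne i i<k x∈t
    ... | inj₁ needed = needed
    ... | inj₂ (at j i<j j<k _ x∈tⱼ) with fuel
    ...   | zero = ⊥-elim (<-irrefl refl (≤-trans j<k (≤-trans (subst (ncond ρ ≤_) (+-identityʳ (suc i)) k≤) i<j)))
    ...   | suc fuel′ = neededFrom-weaken ρ (m≤n⇒m≤1+n i<j)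
            (chase fuel′ j j<k (≤-trans k≤ (≤-trans (≤-reflexive (+-suc (suc i) fuel′)) (s≤s (+-monoˡ-≤ fuel′ i<j)))) x∈tⱼ)

  NE⇒lhs-covered : ∀ ρ → UnravelNE ρ → ∀ {x} → x ∈ vars (clhs ρ) →
    x ∈ vars (crhs ρ) ⊎ Occurs noCond (λ c → varsT c ++ varsS c) (conds ρ) 0 (ncond ρ) x
  NE⇒lhs-covered ρ ne {x} x∈l with ne 0 z≤n (∈-embed⁺ (clhs ρ) x∈l) | ncond ρ in k≡
  ... | x∈rhs | zero =
    inj₁ (∈-embed⁻ (crhs ρ) (subst (λ t → x ∈ vars t) (trans (cong (rhsAt ρ) (sym k≡)) (rhsAt-last ρ)) x∈rhs))
  ... | x∈rhs | suc _ with ∈U⁻ ρ 1 (sAt ρ 0) (subst (λ t → x ∈ vars t) (rhsAt-< ρ 0 (subst (0 <_) (sym k≡) (s≤s z≤n))) x∈rhs)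
  ... | inj₁ x∈s = inj₂ (at 0 z≤n (s≤s z≤n) (subst (0 <_) (sym k≡) (s≤s z≤n)) (∈-++⁺ʳ (varsT (nth noCond (conds ρ) 0)) x∈s))
  ... | inj₂ x∈Z with proj₂ (∈Z⁻ ρ 0 x∈Z)
  ... | inj₁ x∈r = inj₁ x∈r
  ... | inj₂ (inj₁ occT) = inj₂ (occurs-map noCond (λ c → ∈-++⁺ˡ) (occurs-weaken noCond z≤n (≤-reflexive k≡) occT))
  ... | inj₂ (inj₂ occS) = inj₂ (occurs-map noCond (λ c → ∈-++⁺ʳ (varsT c)) (occurs-weaken noCond z≤n (≤-reflexive k≡) occS))

  -- A variable of X_{n+1} that is needed from n on lies on the right-hand
  -- side of the n-th unraveled rule: in sₙ₊₁, or else it is kept in Z_{n+1}.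
  needed⇒∈rhs : ∀ ρ n → n ≤ ncond ρ → ∀ {x} → NeededFrom ρ n x → InX ρ n x → x ∈ vars (rhsAt ρ n)
  needed⇒∈rhs ρ n n≤k {x} needed inX with m≤n⇒m<n∨m≡n n≤k
  needed⇒∈rhs ρ n n≤k {x} (inj₁ x∈r) inX | inj₂ refl = subst (λ t → x ∈ vars t) (sym (rhsAt-last ρ)) (∈-embed⁺ (crhs ρ) x∈r)
  needed⇒∈rhs ρ n n≤k {x} (inj₂ (at j n≤j j<k _ _)) inX | inj₂ refl = ⊥-elim (<-irrefl refl (≤-trans j<k n≤j))
  needed⇒∈rhs ρ n n≤k {x} (inj₁ x∈r) inX | inj₁ n<k =
    subst (λ t → x ∈ vars t) (sym (rhsAt-< ρ n n<k)) (∈U-Z ρ (suc n) (sAt ρ n) (∈Z⁺ ρ n inX (inj₁ x∈r)))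
  needed⇒∈rhs ρ n n≤k {x} (inj₂ (at j n≤j j<k j<len x∈s)) inX | inj₁ n<k with m≤n⇒m<n∨m≡n n≤j
  ... | inj₂ refl = subst (λ t → x ∈ vars t) (sym (rhsAt-< ρ n n<k)) (∈U-arg ρ (suc n) (sAt ρ n) x∈s)
  ... | inj₁ n<j = subst (λ t → x ∈ vars t) (sym (rhsAt-< ρ n n<k))
         (∈U-Z ρ (suc n) (sAt ρ n) (∈Z⁺ ρ n inX (inj₂ (inj₂ (at j n<j j<k j<len x∈s)))))

  forward⇒NE : ∀ ρ → Forward ρ → LhsNeeded ρ → UnravelNE ρ
  forward⇒NE ρ fwd lhs zero n≤k x∈l =
    needed⇒∈rhs ρ 0 n≤k (lhs (∈-embed⁻ (clhs ρ) x∈l)) (inj₁ (∈-embed⁻ (clhs ρ) x∈l))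
  forward⇒NE ρ fwd lhs (suc m) n≤k {x} x∈lhs with ∈U⁻ ρ (suc m) (tAt ρ m) x∈lhs
  ... | inj₁ x∈t = needed⇒∈rhs ρ (suc m) n≤k (fwd m n≤k x∈t) (inj₂ (at m z≤n ≤-refl n≤k x∈t))
  ... | inj₂ x∈Z with ∈Z⁻ ρ m x∈Z
  ... | inX , inY = needed⇒∈rhs ρ (suc m) n≤k (stillNeeded inY) (widen inX)
    where
    widen : InX ρ m x → InX ρ (suc m) x
    widen (inj₁ x∈l) = inj₁ x∈l
    widen (inj₂ occ) = inj₂ (occurs-weaken noCond ≤-refl (n≤1+n m) occ)
    stillNeeded : InY ρ m x → NeededFrom ρ (suc m) x
    stillNeeded (inj₁ x∈r) = inj₁ x∈r
    stillNeeded (inj₂ (inj₁ (at j m≤j j<k _ x∈t))) = neededFrom-weaken ρ (s≤s m≤j) (fwd j j<k x∈t)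
    stillNeeded (inj₂ (inj₂ occ)) = inj₂ occ

module Inversion {F : Set} (l r : Term F) (cs : List (Cond F)) where
  ρ ρ⁻ : CRule F
  ρ = l ⇒ r ⇐ cs
  ρ⁻ = invC ρ

  k : ℕ
  k = length cs

  length-cs⁻ : length (revSwap cs) ≡ k
  length-cs⁻ = length-revSwap (var 0) cs

  cond-mirror : ∀ j → j < k → nth noCond (revSwap cs) j ≡ swap (nth noCond cs (k ∸ suc j))
  cond-mirror = nth-revSwap (var 0) cs

  toℕ<k : ∀ (i : Fin (length (revSwap cs))) → toℕ i < k
  toℕ<k i = subst (toℕ i <_) length-cs⁻ (toℕ<n i)

  lookup-cs⁻ : ∀ (i : Fin (length (revSwap cs))) → lookup (revSwap cs) i ≡ swap (nth noCond cs (k ∸ suc (toℕ i)))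
  lookup-cs⁻ i = trans (lookup≡nth noCond (revSwap cs) i) (cond-mirror (toℕ i) (toℕ<k i))

  mirrorPos : ∀ {i} → i < k → Fin (length (revSwap cs))
  mirrorPos {i} i<k = fromℕ< (subst (k ∸ suc i <_) (sym length-cs⁻) (mirror-< i<k))

  toℕ-mirrorPos : ∀ {i} (i<k : i < k) → toℕ (mirrorPos i<k) ≡ k ∸ suc i
  toℕ-mirrorPos i<k = toℕ-fromℕ< _

  lookup-mirrorPos : ∀ {i} (i<k : i < k) → lookup (revSwap cs) (mirrorPos i<k) ≡ swap (nth noCond cs i)
  lookup-mirrorPos {i} i<k = begin
    lookup (revSwap cs) (mirrorPos i<k)                   ≡⟨ lookup-cs⁻ (mirrorPos i<k) ⟩
    swap (nth noCond cs (k ∸ suc (toℕ (mirrorPos i<k))))  ≡⟨ cong (λ n → swap (nth noCond cs (k ∸ suc n))) (toℕ-mirrorPos i<k) ⟩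
    swap (nth noCond cs (k ∸ suc (k ∸ suc i)))            ≡⟨ cong (λ n → swap (nth noCond cs n)) (mirror-mirror i<k) ⟩
    swap (nth noCond cs i)                                ∎
    where open ≡-Reasoning

  bothVars : Cond F → List ℕ
  bothVars c = vars (proj₁ c) ++ vars (proj₂ c)

  -- ρ⁻ is deterministic iff ρ is forward: the sources of ρ⁻ are the targets
  -- of ρ in reverse order, and "earlier targets of ρ⁻" are "later sources of ρ".
  forward⇒invDeterministic : Forward ρ → Deterministic ρ⁻
  forward⇒invDeterministic fwd i {x} x∈s with fwd _ (mirror-< (toℕ<k i)) (subst (λ c → x ∈ vars (proj₁ c)) (lookup-cs⁻ i) x∈s)
  ... | inj₁ x∈r = ∈-++⁺ˡ x∈r
  ... | inj₂ occS = ∈-++⁺ʳ (vars r) (occurs-take⁺ noCond (toℕ i) (revSwap cs)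
          (occurs-revSwap⁺ (var 0) varsT cs {lo = 0} {hi = toℕ i}
            (subst (λ n → OccursS ρ n k x) (suc-mirror (toℕ<k i)) occS)))

  invDeterministic⇒forward : Deterministic ρ⁻ → Forward ρ
  invDeterministic⇒forward det i i<k {x} x∈t
    with ∈-++⁻ (vars r) (det (mirrorPos i<k) (subst (λ c → x ∈ vars (proj₁ c)) (sym (lookup-mirrorPos i<k)) x∈t))
  ... | inj₁ x∈r = inj₁ x∈r
  ... | inj₂ x∈ts = inj₂ (subst (λ n → OccursS ρ n k x) (m∸[m∸n]≡n i<k)
          (occurs-revSwap⁻ (var 0) varsT cs {lo = 0} {hi = k ∸ suc i}
            (subst (λ n → Occurs noCond varsT (revSwap cs) 0 n x) (toℕ-mirrorPos i<k)
              (occurs-take⁻ noCond _ (revSwap cs) x∈ts))))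

  NE⇒invType3 : UnravelNE ρ → Type3 ρ⁻
  NE⇒invType3 ne {x} x∈l with NE⇒lhs-covered ρ ne x∈l
  ... | inj₁ x∈r = ∈-++⁺ˡ x∈r
  ... | inj₂ occ = ∈-++⁺ʳ (vars r) (occurs-concatMap⁺ noCond (revSwap cs)
          (occurs-revSwap⁺ (var 0) bothVars cs {lo = 0} {hi = k} (occurs-weaken noCond (≤-reflexive (n∸n≡0 k)) ≤-refl occ)))

  -- Under the forward property, a variable of l occurring in some tⱼ is
  -- needed later, so Type 3 of ρ⁻ makes all of l needed.
  invType3⇒lhsNeeded : Type3 ρ⁻ → Forward ρ → LhsNeeded ρ
  invType3⇒lhsNeeded type3 fwd {x} x∈l with ∈-++⁻ (vars r) (type3 x∈l)
  ... | inj₁ x∈r = inj₁ x∈r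
  ... | inj₂ x∈cs with occurs-revSwap⁻ (var 0) bothVars cs (occurs-concatMap⁻ noCond (revSwap cs) x∈cs)
  ... | at j _ j<k _ x∈c with ∈-++⁻ (varsT (nth noCond cs j)) x∈c
  ... | inj₁ x∈t = neededFrom-weaken ρ z≤n (fwd j j<k x∈t)
  ... | inj₂ x∈s = inj₂ (at j z≤n j<k j<k x∈s)

  module Mirror (pdet : PositionallyDet ρ) (fwd : Forward ρ) {m} (m<k : m < k) where
    k⁻ p : ℕ
    k⁻ = length (revSwap cs)
    p = k ∸ suc m

    suc-p : suc p ≡ k ∸ m
    suc-p = suc-mirror m<k

    k∸k⁻≤0 : k ∸ k⁻ ≤ 0
    k∸k⁻≤0 = ≤-reflexive (trans (cong (k ∸_) length-cs⁻) (n∸n≡0 k))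

    T⁻-below⇒S-above : ∀ {x} → OccursT ρ⁻ 0 m x → OccursS ρ (suc p) k x
    T⁻-below⇒S-above {x} occ = subst (λ n → OccursS ρ n k x) (sym suc-p) (occurs-revSwap⁻ (var 0) varsT cs occ)

    S-above⇒T⁻-below : ∀ {x} → OccursS ρ (suc p) k x → OccursT ρ⁻ 0 m x
    S-above⇒T⁻-below {x} occ = occurs-revSwap⁺ (var 0) varsT cs {lo = 0} {hi = m} (subst (λ n → OccursS ρ n k x) suc-p occ)

    S⁻-above⇒T-below : ∀ {x} → OccursS ρ⁻ (suc m) k⁻ x → OccursT ρ 0 p x
    S⁻-above⇒T-below occ = occurs-weaken noCond z≤n ≤-refl (occurs-revSwap⁻ (var 0) varsS cs occ)

    T-below⇒S⁻-above : ∀ {x} → OccursT ρ 0 p x → OccursS ρ⁻ (suc m) k⁻ x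
    T-below⇒S⁻-above occ = occurs-revSwap⁺ (var 0) varsS cs {lo = suc m} {hi = k⁻} (occurs-weaken noCond k∸k⁻≤0 ≤-refl occ)

    T⁻-above⇒S-upTo : ∀ {x} → OccursT ρ⁻ m k⁻ x → OccursS ρ 0 (suc p) x
    T⁻-above⇒S-upTo occ = occurs-weaken noCond z≤n (≤-reflexive (sym suc-p)) (occurs-revSwap⁻ (var 0) varsT cs occ)

    invX⇒Y : ∀ {x} → InX ρ⁻ m x → InY ρ p x
    invX⇒Y (inj₁ x∈r) = inj₁ x∈r
    invX⇒Y (inj₂ occ) = inj₂ (inj₂ (T⁻-below⇒S-above occ))

    -- A source of ρ up to p lies in X_{p+1} by determinism.
    invY⇒X : ∀ {x} → InY ρ⁻ m x → InX ρ p x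
    invY⇒X (inj₁ x∈l) = inj₁ x∈l
    invY⇒X (inj₂ (inj₁ occ)) with T⁻-above⇒S-upTo occ
    ... | at j _ j≤p j<k x∈s with pdet j j<k x∈s
    ...   | inj₁ x∈l = inj₁ x∈l
    ...   | inj₂ occT = inj₂ (occurs-weaken noCond ≤-refl (s≤s⁻¹ j≤p) occT)
    invY⇒X (inj₂ (inj₂ occ)) = inj₂ (S⁻-above⇒T-below occ)

    X⇒invY : ∀ {x} → InX ρ p x → InY ρ⁻ m x
    X⇒invY (inj₁ x∈l) = inj₁ x∈l
    X⇒invY (inj₂ occ) = inj₂ (inj₂ (T-below⇒S⁻-above occ))

    -- A target of ρ from p on is needed later by the forward property.
    Y⇒invX : ∀ {x} → InY ρ p x → InX ρ⁻ m x
    Y⇒invX (inj₁ x∈r) = inj₁ x∈r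
    Y⇒invX (inj₂ (inj₁ (at j p≤j j<k _ x∈t))) with fwd j j<k x∈t
    ... | inj₁ x∈r = inj₁ x∈r
    ... | inj₂ occS = inj₂ (S-above⇒T⁻-below (occurs-weaken noCond (s≤s p≤j) ≤-refl occS))
    Y⇒invX (inj₂ (inj₂ occ)) = inj₂ (S-above⇒T⁻-below occ)

    Z-mirror : Z ρ⁻ (suc m) ≡ Z ρ (suc p)
    Z-mirror = Z-ext ρ⁻ (suc m) ρ (suc p)
      (λ x∈ → let inX , inY = ∈Z⁻ ρ⁻ m x∈ in ∈Z⁺ ρ p (invY⇒X inY) (invX⇒Y inX))
      (λ x∈ → let inX , inY = ∈Z⁻ ρ p x∈ in ∈Z⁺ ρ⁻ m (Y⇒invX inY) (X⇒invY inX))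

  module UnravelMirror (pdet : PositionallyDet ρ) (fwd : Forward ρ) where
    renameU-U : ∀ i t → mapSym renameU (U ρ i t) ≡ fun (inj₂ (ρ⁻ , suc (k ∸ i))) (embed t ∷ map var (Z ρ i))
    renameU-U i t = cong₂ (λ a zs → fun (inj₂ (ρ⁻ , suc (k ∸ i))) (a ∷ zs)) (renameU-embed t) (mapSymL-vars renameU (Z ρ i))

    U-mirror : ∀ {m} → m < k → ∀ t → mapSym renameU (U ρ (suc (k ∸ suc m)) t) ≡ U ρ⁻ (suc m) t
    U-mirror {m} m<k t = trans (renameU-U (suc (k ∸ suc m)) t)
      (cong₂ (λ j zs → fun (inj₂ (ρ⁻ , j)) (embed t ∷ map var zs)) (cong suc (mirror-mirror m<k)) (sym (Mirror.Z-mirror pdet fwd m<k)))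

    lhs-mirror : ∀ n → n ≤ k → lhsAt ρ⁻ n ≡ mapSym renameU (rhsAt ρ (k ∸ n))
    lhs-mirror zero _ = begin
      embed r                       ≡⟨ sym (renameU-embed r) ⟩
      mapSym renameU (embed r)      ≡⟨ cong (mapSym renameU) (sym (rhsAt-last ρ)) ⟩
      mapSym renameU (rhsAt ρ k)    ∎
      where open ≡-Reasoning
    lhs-mirror (suc m) m<k = begin
      U ρ⁻ (suc m) (tAt ρ⁻ m)                                       ≡⟨ cong (λ c → U ρ⁻ (suc m) (proj₂ c)) (cond-mirror m m<k) ⟩
      U ρ⁻ (suc m) (sAt ρ (k ∸ suc m))                              ≡⟨ sym (U-mirror m<k _) ⟩
      mapSym renameU (U ρ (suc (k ∸ suc m)) (sAt ρ (k ∸ suc m)))    ≡⟨ cong (mapSym renameU) (sym (rhsAt-< ρ _ (mirror-< m<k))) ⟩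
      mapSym renameU (rhsAt ρ (k ∸ suc m))                          ∎
      where open ≡-Reasoning

    rhs-mirror : ∀ n → n ≤ k → rhsAt ρ⁻ n ≡ mapSym renameU (lhsAt ρ (k ∸ n))
    rhs-mirror n n≤k with m≤n⇒m<n∨m≡n n≤k
    ... | inj₂ refl = begin
      rhsAt ρ⁻ k                          ≡⟨ cong (rhsAt ρ⁻) (sym length-cs⁻) ⟩
      rhsAt ρ⁻ (ncond ρ⁻)                 ≡⟨ rhsAt-last ρ⁻ ⟩
      embed l                             ≡⟨ sym (renameU-embed l) ⟩
      mapSym renameU (embed l)            ≡⟨ cong (λ j → mapSym renameU (lhsAt ρ j)) (sym (n∸n≡0 k)) ⟩
      mapSym renameU (lhsAt ρ (k ∸ k))    ∎
      where open ≡-Reasoning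
    ... | inj₁ n<k = begin
      rhsAt ρ⁻ n                                   ≡⟨ rhsAt-< ρ⁻ n (subst (n <_) (sym length-cs⁻) n<k) ⟩
      U ρ⁻ (suc n) (sAt ρ⁻ n)                      ≡⟨ cong (λ c → U ρ⁻ (suc n) (proj₁ c)) (cond-mirror n n<k) ⟩
      U ρ⁻ (suc n) (tAt ρ (k ∸ suc n))             ≡⟨ sym (U-mirror n<k _) ⟩
      mapSym renameU (lhsAt ρ (suc (k ∸ suc n)))   ≡⟨ cong (λ j → mapSym renameU (lhsAt ρ j)) (suc-mirror n<k) ⟩
      mapSym renameU (lhsAt ρ (k ∸ n))             ∎
      where open ≡-Reasoning

    rule-mirror : ∀ n → n ≤ k → ruleAt ρ⁻ n ≡ renameRule (invRule (ruleAt ρ (k ∸ n)))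
    rule-mirror n n≤k = cong₂ _⟶_ (lhs-mirror n n≤k) (rhs-mirror n n≤k)

    Uopt-inverse : Uopt ρ⁻ ≋ map renameRule (invTRS (Uopt ρ))
    Uopt-inverse = Uopt⁻⊆ , ⊆Uopt⁻
      where
      Uopt⁻⊆ : Uopt ρ⁻ ⊆ map renameRule (invTRS (Uopt ρ))
      Uopt⁻⊆ x∈ =
        let n , n≤k⁻ , x≡ = ∈Uopt⁻ ρ⁻ x∈
        in subst (_∈ map renameRule (invTRS (Uopt ρ))) (sym (trans x≡ (rule-mirror n (subst (n ≤_) length-cs⁻ n≤k⁻))))
             (∈-renamedInverse⁺ (∈Uopt⁺ ρ (m∸n≤m k n)))
      ⊆Uopt⁻ : map renameRule (invTRS (Uopt ρ)) ⊆ Uopt ρ⁻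
      ⊆Uopt⁻ x∈ with ∈-renamedInverse⁻ x∈
      ... | z , z∈ , x≡ with ∈Uopt⁻ ρ z∈
      ... | n , n≤k , z≡ = subst (_∈ Uopt ρ⁻)
              (trans (rule-mirror (k ∸ n) (m∸n≤m k n))
                (trans (cong (λ j → renameRule (invRule (ruleAt ρ j))) (m∸[m∸n]≡n n≤k))
                  (sym (trans x≡ (cong (λ z → renameRule (invRule z)) z≡)))))
              (∈Uopt⁺ ρ⁻ (subst (k ∸ n ≤_) (sym length-cs⁻) (m∸n≤m k n)))

module _ {A B : Set} {P : B → Set} where
  All-concatMap⇔ : ∀ (f : A → List B) xs → All P (concatMap f xs) ⇔ All (λ x → All P (f x)) xs
  All-concatMap⇔ f xs = mk⇔ (λ all → All.map⁻ (All.concat⁻ all)) (λ all → All.concat⁺ (All.map⁺ all))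

  All-map⇔ : ∀ (f : A → B) xs → All P (map f xs) ⇔ All (λ x → P (f x)) xs
  All-map⇔ f xs = mk⇔ All.map⁻ All.map⁺

All-cong⇔ : ∀ {A : Set} {P Q : A → Set} → (∀ x → P x ⇔ Q x) → ∀ {xs} → All P xs ⇔ All Q xs
All-cong⇔ P⇔Q = mk⇔ (All.map (λ {x} → Equivalence.to (P⇔Q x))) (All.map (λ {x} → Equivalence.from (P⇔Q x)))

module _ {F : Set} where
  unravelNE⇔inv3 : ∀ (ρ : CRule F) → UnravelNE ρ ⇔ (Deterministic (invC ρ) × Type3 (invC ρ))
  unravelNE⇔inv3 (l ⇒ r ⇐ cs) = mk⇔
    (λ ne → forward⇒invDeterministic (NE⇒forward ρ ne) , λ {x} → NE⇒invType3 ne {x})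
    (λ inv3 → let fwd = invDeterministic⇒forward (proj₁ inv3) in forward⇒NE ρ fwd (invType3⇒lhsNeeded (λ {x} → proj₂ inv3 {x}) fwd))
    where open Inversion l r cs

  Uopt-NE⇔ : ∀ (ρ : CRule F) → All NE (Uopt ρ) ⇔ UnravelNE ρ
  Uopt-NE⇔ ρ = mk⇔
    (λ all n n≤k → All.lookup all (∈Uopt⁺ ρ n≤k))
    (λ ne → All.tabulate (ruleNE ne))
    where
    ruleNE : UnravelNE ρ → ∀ {z} → z ∈ Uopt ρ → NE z
    ruleNE ne z∈ with ∈Uopt⁻ ρ z∈
    ... | n , n≤k , refl = ne n n≤k

  Uopt-invC : ∀ (ρ : CRule F) → Deterministic ρ → UnravelNE ρ → Uopt (invC ρ) ≋ map renameRule (invTRS (Uopt ρ))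
  Uopt-invC (l ⇒ r ⇐ cs) det ne =
    UnravelMirror.Uopt-inverse (deterministic⇒positionallyDet ρ det) (NE⇒forward ρ ne)
    where open Inversion l r cs

  renamedInverse-++ : ∀ (A B : List (Rule (USig F))) →
    map renameRule (invTRS (A ++ B)) ≡ map renameRule (invTRS A) ++ map renameRule (invTRS B)
  renamedInverse-++ A B = trans (cong (map renameRule) (map-++ invRule A B)) (map-++ renameRule (invTRS A) (invTRS B))

  UoptR-invR : ∀ (R : List (CRule F)) → All (λ ρ → Uopt (invC ρ) ≋ map renameRule (invTRS (Uopt ρ))) R →
    UoptR (invR R) ≋ map renameRule (invTRS (UoptR R))
  UoptR-invR [] [] = (λ ()) , (λ ())
  UoptR-invR (ρ ∷ R) ((⊆₁ , ⊇₁) ∷ rest) with UoptR-invR R rest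
  ... | ⊆₂ , ⊇₂ rewrite renamedInverse-++ (Uopt ρ) (UoptR R) = ++⁺ ⊆₁ ⊆₂ , ++⁺ ⊇₁ ⊇₂

  transfer : ∀ {A B : List (Rule (USig F))} {P Q : Rule (USig F) → Set} →
    A ≋ map renameRule (invTRS B) → (∀ z → P z ⇔ Q (renameRule (invRule z))) → All P B ⇔ All Q A
  transfer {Q = Q} (A⊆ , ⊆A) P⇔Q = mk⇔
    (λ allB → All.tabulate λ x∈ → let z , z∈ , x≡ = ∈-renamedInverse⁻ (A⊆ x∈) in
       subst Q (sym x≡) (Equivalence.to (P⇔Q z) (All.lookup allB z∈)))
    (λ allA → All.tabulate λ {z} z∈ → Equivalence.from (P⇔Q z) (All.lookup allA (⊆A (∈-renamedInverse⁺ z∈))))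

  -- Inversion swaps the sides of a rule and renaming keeps variable lists.
  LL⇔RL-renamedInverse : ∀ (z : Rule (USig F)) → LL z ⇔ RL (renameRule (invRule z))
  LL⇔RL-renamedInverse (a ⟶ b) = mk⇔ (subst Unique (sym (vars-mapSym renameU a))) (subst Unique (vars-mapSym renameU a))

  RL⇔LL-renamedInverse : ∀ (z : Rule (USig F)) → RL z ⇔ LL (renameRule (invRule z))
  RL⇔LL-renamedInverse (a ⟶ b) = mk⇔ (subst Unique (sym (vars-mapSym renameU b))) (subst Unique (vars-mapSym renameU b))

  nonLV⇔inv-nonRV : ∀ (ρ : CRule F) → (¬ IsVar (clhs ρ)) ⇔ (¬ IsVar (crhs (invC ρ)))
  nonLV⇔inv-nonRV (l ⇒ r ⇐ cs) = ⇔-id _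

  nonRV⇔inv-nonLV : ∀ (ρ : CRule F) → (¬ IsVar (crhs ρ)) ⇔ (¬ IsVar (clhs (invC ρ)))
  nonRV⇔inv-nonLV (l ⇒ r ⇐ cs) = ⇔-id _

theorem4p7 : {F : Set} (R : List (CRule F)) → IseDCTRS R →
    (UoptHas NE R ⇔ Is3eDCTRS (invR R))
    × (UoptHas NE R →
        (UoptR (invR R) ≋ map renameRule (invTRS (UoptR R)))
        × (UoptHas LL R ⇔ UoptHas RL (invR R))
        × (UoptHas RL R ⇔ UoptHas LL (invR R)))
    × (NonLVR R ⇔ NonRVR (invR R))
    × (NonRVR R ⇔ NonLVR (invR R))
theorem4p7 R det = part1 , part2 , part3 , part4
  where
  uoptNE⇔ : UoptHas NE R ⇔ All UnravelNE R
  uoptNE⇔ = All-cong⇔ Uopt-NE⇔ ⇔-∘ All-concatMap⇔ Uopt R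

  part1 : UoptHas NE R ⇔ Is3eDCTRS (invR R)
  part1 = ⇔-sym (All-map⇔ invC R) ⇔-∘ (All-cong⇔ unravelNE⇔inv3 ⇔-∘ uoptNE⇔)

  part2 : UoptHas NE R →
    (UoptR (invR R) ≋ map renameRule (invTRS (UoptR R)))
    × (UoptHas LL R ⇔ UoptHas RL (invR R))
    × (UoptHas RL R ⇔ UoptHas LL (invR R))
  part2 uoptNE = inverse , transfer inverse LL⇔RL-renamedInverse , transfer inverse RL⇔LL-renamedInverse
    where
    inverse : UoptR (invR R) ≋ map renameRule (invTRS (UoptR R))
    inverse = UoptR-invR R (All.zipWith (λ (d , ne) → Uopt-invC _ d ne) (det , Equivalence.to uoptNE⇔ uoptNE))

  part3 : NonLVR R ⇔ NonRVR (invR R)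
  part3 = ⇔-sym (All-map⇔ invC R) ⇔-∘ All-cong⇔ nonLV⇔inv-nonRV

  part4 : NonRVR R ⇔ NonLVR (invR R)
  part4 = ⇔-sym (All-map⇔ invC R) ⇔-∘ All-cong⇔ nonRV⇔inv-nonLV
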